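{- Let $\phi(x_1,\dots,x_n,y_1,\dots,y_m)$ be an $\mathcal{L}$-formula with a stratification $\sigma:\mathbf{Var}(\phi)\to\{0,1\}$ such that $\sigma(x_i)=0$ for all $1\le i\le n$ and $\sigma(y_i)=1$ for all $1\le i\le m$. Let $\mathcal{M}=\langle M,\in^{\mathcal{M}}\rangle$ be a model of $\mathrm{BAS}$. Then for all $a_1,\dots,a_n,b_1,\dots,b_m\in M$, $$\mathcal{M}\models\phi(a_1,\dots,a_n,b_1,\dots,b_m)\iff\langle M,\subseteq^{\mathcal{M}}\rangle\models\phi^\tau(\{a_1\},\dots,\{a_n\},b_1,\dots,b_m),$$ where $\{a\}$ denotes the unique element of $M$ whose only $\in^{\mathcal{M}}$-element is $a$.
   Context: $\mathcal{L}$ is the first-order language with one binary relation $\in$; $\mathcal{L}_{po}$ is the language with one binary relation $\sqsubseteq$. $\mathbf{Var}(\phi)$ is the set of variables (free and bound) in $\phi$. A stratification of $\phi$ is a map $\sigma:\mathbf{Var}(\phi)\to\mathbb{N}$ such that $\sigma(y)=\sigma(x)+1$ whenever $x\in y$ is a subformula and $\sigma(y)=\sigma(x)$ whenever $x=y$ is a subformula. $\mathbf{Atm}(x)$ is the $\mathcal{L}_{po}$-formula $(\exists z\forall w(z\sqsubseteq w)\land \neg\forall w(x\sqsubseteq w))\land\forall y(y\sqsubseteq x\Rightarrow \forall w(y\sqsubseteq w)\lor y=x)$, i.e. "$x$ is nonzero and the only elements below $x$ are the least element and $x$". Given $\phi$ with stratification $\sigma$ into $\{0,1\}$, $\phi^\tau$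 is defined recursively: $(u\in v)^\tau$ is $\mathbf{Atm}(u)\land u\sqsubseteq v$; $(u=v)^\tau$ is $u=v$; $\tau$ commutes with $\neg,\land,\lor,\Rightarrow,\iff$; $(\exists v\,\psi)^\tau$ is $\exists v(\mathbf{Atm}(v)\land\psi^\tau)$ if $\sigma(v)=0$ and $\exists v\,\psi^\tau$ if $\sigma(v)=1$; $(\forall v\,\psi)^\tau$ is $\forall v(\mathbf{Atm}(v)\Rightarrow\psi^\tau)$ if $\sigma(v)=0$ and $\forall v\,\psi^\tau$ if $\sigma(v)=1$. $\mathrm{BAS}$ is the $\mathcal{L}$-theory with axioms: (Emp) $\exists x\forall y(y\notin x)$; (Adj) $\forall x\forall y\exists z\forall u(u\in z\iff(u\in x\lor u=y))$; (Ext) extensionality; (Union), (Intersection), (RelComp): for all $x,y$ the sets $x\cup y$, $x\cap y$, $x- y$ exist (defined by the obvious membership conditions); (UB) $\forall x\exists y(y\notin x)$. $a\subseteq^{\mathcal{M}}b$ iff every $\in^{\mathcal{M}}$-element of $a$ is an $\in^{\mathcal{M}}$-element of $b$. -}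

module Defs where

open import Data.Nat using (ℕ; zero; suc; _+_; _≤_; _≟_)
open import Data.Fin using (Fin)
open import Data.List using (List; []; _∷_; _++_; filter)
open import Data.List.Membership.Propositional using (_∈_)
open import Data.Product using (Σ; _×_; _,_)
open import Data.Sum using (_⊎_)
open import Data.Empty using (⊥)
open import Relation.Nullary using (¬_; Dec; yes; no)
open import Relation.Nullary.Decidable using (⌊_⌋)
open import Relation.Binary.PropositionalEquality using (_≡_)
open import Function.Bundles using (_⇔_)

-- For the language 𝓛
-- `rel` is ∈; for 𝓛_po it is ⊑.

Var : Set
Var = ℕ

infix  7 _≐_
infixr 6 _∧'_
infixr 5 _∨'_
infixr 4 _⇒'_ _⇔'_

data Formula : Set where
  rel   : Var → Var → Formula
  _≐_   : Var → Var → Formula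
  ¬'_   : Formula → Formula
  _∧'_  : Formula → Formula → Formula
  _∨'_  : Formula → Formula → Formula
  _⇒'_  : Formula → Formula → Formula
  _⇔'_  : Formula → Formula → Formula
  ∃'    : Var → Formula → Formula
  ∀'    : Var → Formula → Formula

Vars : Formula → List Var
Vars (rel x y) = x ∷ y ∷ []
Vars (x ≐ y)   = x ∷ y ∷ []
Vars (¬' φ)    = Vars φ
Vars (φ ∧' ψ)  = Vars φ ++ Vars ψ
Vars (φ ∨' ψ)  = Vars φ ++ Vars ψ
Vars (φ ⇒' ψ)  = Vars φ ++ Vars ψ
Vars (φ ⇔' ψ)  = Vars φ ++ Vars ψ
Vars (∃' v φ)  = v ∷ Vars φ
Vars (∀' v φ)  = v ∷ Vars φ

remove : Var → List Var → List Var
remove v = filter (λ w → Relation.Nullary.¬? (w ≟ v))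

FV : Formula → List Var
FV (rel x y) = x ∷ y ∷ []
FV (x ≐ y)   = x ∷ y ∷ []
FV (¬' φ)    = FV φ
FV (φ ∧' ψ)  = FV φ ++ FV ψ
FV (φ ∨' ψ)  = FV φ ++ FV ψ
FV (φ ⇒' ψ)  = FV φ ++ FV ψ
FV (φ ⇔' ψ)  = FV φ ++ FV ψ
FV (∃' v φ)  = remove v (FV φ)
FV (∀' v φ)  = remove v (FV φ)

StratCond : (Var → ℕ) → Formula → Set
StratCond σ (rel x y) = σ y ≡ suc (σ x)
StratCond σ (x ≐ y)   = σ y ≡ σ x
StratCond σ (¬' φ)    = StratCond σ φ
StratCond σ (φ ∧' ψ)  = StratCond σ φ × StratCond σ ψ
StratCond σ (φ ∨' ψ)  = StratCond σ φ × StratCond σ ψ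
StratCond σ (φ ⇒' ψ)  = StratCond σ φ × StratCond σ ψ
StratCond σ (φ ⇔' ψ)  = StratCond σ φ × StratCond σ ψ
StratCond σ (∃' v φ)  = StratCond σ φ
StratCond σ (∀' v φ)  = StratCond σ φ

IsStrat01 : (Var → ℕ) → Formula → Set
IsStrat01 σ φ = StratCond σ φ × (∀ {v} → v ∈ Vars φ → σ v ≤ 1)

-- The 𝓛_po-formula Atm(x).  Its bound variables are x+1, x+2, which are
-- distinct from its only free variable x, so no capture occurs.

Atm : Var → Formula
Atm x =
  (∃' z (∀' w (rel z w)) ∧' ¬' (∀' w (rel x w)))
  ∧' ∀' y (rel y x ⇒' (∀' w (rel y w) ∨' (y ≐ x)))
  where
    z = suc x
    y = suc x
    w = suc (suc x)

τ : (Var → ℕ) → Formula → Formula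
τ σ (rel u v) = Atm u ∧' rel u v
τ σ (u ≐ v)   = u ≐ v
τ σ (¬' φ)    = ¬' τ σ φ
τ σ (φ ∧' ψ)  = τ σ φ ∧' τ σ ψ
τ σ (φ ∨' ψ)  = τ σ φ ∨' τ σ ψ
τ σ (φ ⇒' ψ)  = τ σ φ ⇒' τ σ ψ
τ σ (φ ⇔' ψ)  = τ σ φ ⇔' τ σ ψ
τ σ (∃' v φ) with σ v
... | zero  = ∃' v (Atm v ∧' τ σ φ)
... | suc _ = ∃' v (τ σ φ)
τ σ (∀' v φ) with σ v
... | zero  = ∀' v (Atm v ⇒' τ σ φ)
... | suc _ = ∀' v (τ σ φ)

record Structure : Set₁ where
  field
    Carrier : Set
    R       : Carrier → Carrier → Set

open Structure public

Env : Structure → Set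
Env 𝓜 = Var → Carrier 𝓜

_[_↦_] : {𝓜 : Structure} → Env 𝓜 → Var → Carrier 𝓜 → Env 𝓜
(ρ [ v ↦ a ]) w with w ≟ v
... | yes _ = a
... | no  _ = ρ w

Sat : (𝓜 : Structure) → Env 𝓜 → Formula → Set
Sat 𝓜 ρ (rel x y) = R 𝓜 (ρ x) (ρ y)
Sat 𝓜 ρ (x ≐ y)   = ρ x ≡ ρ y
Sat 𝓜 ρ (¬' φ)    = ¬ Sat 𝓜 ρ φ
Sat 𝓜 ρ (φ ∧' ψ)  = Sat 𝓜 ρ φ × Sat 𝓜 ρ ψ
Sat 𝓜 ρ (φ ∨' ψ)  = Sat 𝓜 ρ φ ⊎ Sat 𝓜 ρ ψ
Sat 𝓜 ρ (φ ⇒' ψ)  = Sat 𝓜 ρ φ → Sat 𝓜 ρ ψ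
Sat 𝓜 ρ (φ ⇔' ψ)  = Sat 𝓜 ρ φ ⇔ Sat 𝓜 ρ ψ
Sat 𝓜 ρ (∃' v φ)  = Σ (Carrier 𝓜) (λ a → Sat 𝓜 (_[_↦_] {𝓜} ρ v a) φ)
Sat 𝓜 ρ (∀' v φ)  = (a : Carrier 𝓜) → Sat 𝓜 (_[_↦_] {𝓜} ρ v a) φ

module _ (𝓜 : Structure) where
  private
    M = Carrier 𝓜
    _∈ᴹ_ = R 𝓜

  record IsBAS : Set where
    field
      emp   : Σ M (λ x → ∀ y → ¬ (y ∈ᴹ x))
      adj   : ∀ x y → Σ M (λ z → ∀ u → (u ∈ᴹ z) ⇔ ((u ∈ᴹ x) ⊎ (u ≡ y)))
      ext   : ∀ x y → (∀ u → (u ∈ᴹ x) ⇔ (u ∈ᴹ y)) → x ≡ y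
      union : ∀ x y → Σ M (λ z → ∀ u → (u ∈ᴹ z) ⇔ ((u ∈ᴹ x) ⊎ (u ∈ᴹ y)))
      inter : ∀ x y → Σ M (λ z → ∀ u → (u ∈ᴹ z) ⇔ ((u ∈ᴹ x) × (u ∈ᴹ y)))
      relc  : ∀ x y → Σ M (λ z → ∀ u → (u ∈ᴹ z) ⇔ ((u ∈ᴹ x) × ¬ (u ∈ᴹ y)))
      ub    : ∀ x → Σ M (λ y → ¬ (y ∈ᴹ x))

  _⊆ᴹ_ : M → M → Set
  a ⊆ᴹ b = ∀ u → u ∈ᴹ a → u ∈ᴹ b

InclStr : Structure → Structure
InclStr 𝓜 = record { Carrier = Carrier 𝓜 ; R = _⊆ᴹ_ 𝓜 }

-- classical logic (the model theory of the paper is classical)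
ExcludedMiddle : Set₁
ExcludedMiddle = (P : Set) → Dec P

-- In ⟨M, ⊆⟩ the atoms are exactly the singletons ｛ a ｝: Emp gives the least element ∅, Adj
-- gives singletons, and Ext with excluded middle shows every atom is one.  So a level-0
-- variable, valued a in 𝓜, is interpreted by ｛ a ｝ in ⟨M, ⊆⟩ and a level-1 variable by
-- itself; then a ∈ b becomes ｛ a ｝ ⊆ b, a = b becomes ｛ a ｝ = ｛ b ｝, and the level-0
-- quantifiers relativised to Atm range over exactly the singletons.  Induction on φ carries
-- this correspondence between the environments through all connectives and quantifiers.
module Submission where

open import Defs
open import Data.Nat using (ℕ; zero; suc; _≤_; _≟_; s≤s⁻¹)
open import Data.Nat.Properties using (<⇒≢; n<1+n; m<n⇒m<1+n; n≤0⇒n≡0)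
open import Data.Fin using (Fin)
open import Data.Product using (Σ; _×_; _,_; proj₁; proj₂)
open import Data.Product.Function.NonDependent.Propositional using (_×-⇔_)
import Data.Product.Function.Dependent.Propositional as Σ
open import Data.Sum using (_⊎_; inj₁; inj₂)
open import Data.Sum.Function.Propositional using (_⊎-⇔_)
open import Data.Empty using (⊥-elim)
open import Data.List using (List; _∷_; _++_)
open import Data.List.Membership.Propositional using (_∈_)
open import Data.List.Membership.Propositional.Properties using (∈-++⁺ˡ; ∈-++⁺ʳ; ∈-filter⁺)
open import Data.List.Relation.Unary.Any using (here; there)
open import Relation.Nullary using (¬_; yes; no; ¬?)
open import Relation.Nullary.Decidable using (toSum)
open import Relation.Binary.PropositionalEquality
open import Function.Bundles using (_⇔_; mk⇔; Equivalence)
open import Function.Properties.Equivalence using () renaming (refl to ⇔-refl; trans to ⇔-trans; sym to ⇔-sym)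
open import Function.Related.Propositional using (K-reflexive; equivalence)
open import Function.Related.TypeIsomorphisms using (→-cong-⇔; ¬-cong-⇔; Related-cong)

open Equivalence using (to; from)

≡⇒⇔ : ∀ {A B : Set} → A ≡ B → A ⇔ B
≡⇒⇔ = K-reflexive {k = equivalence}

Π-cong-⇔ : ∀ {X : Set} {A B : X → Set} → (∀ x → A x ⇔ B x) → ((x : X) → A x) ⇔ ((x : X) → B x)
Π-cong-⇔ A⇔B = mk⇔ (λ f x → to (A⇔B x) (f x)) (λ g x → from (A⇔B x) (g x))

module _ {N : Structure} (ρ : Env N) (v : Var) (a : Carrier N) where

  update-≡ : _[_↦_] {N} ρ v a v ≡ a
  update-≡ with v ≟ v
  ... | yes _ = refl
  ... | no v≢v = ⊥-elim (v≢v refl)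

  update-≢ : ∀ {w} → w ≢ v → _[_↦_] {N} ρ v a w ≡ ρ w
  update-≢ {w} w≢v with w ≟ v
  ... | yes w≡v = ⊥-elim (w≢v w≡v)
  ... | no _ = refl

module _ (N : Structure) where

  IsLeast : Carrier N → Set
  IsLeast e = ∀ f → R N e f

  IsAtom : Carrier N → Set
  IsAtom c = (Σ (Carrier N) IsLeast × ¬ IsLeast c) × (∀ d → R N d c → IsLeast d ⊎ d ≡ c)

  sat-least : ∀ θ u w → u ≢ w → Sat N θ (∀' w (rel u w)) ⇔ IsLeast (θ u)
  sat-least θ u w u≢w = Π-cong-⇔ λ f →
    ≡⇒⇔ (cong₂ (R N) (update-≢ θ w f u≢w) (update-≡ θ w f))

  sat-Atm : ∀ θ x → Sat N θ (Atm x) ⇔ IsAtom (θ x)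
  sat-Atm θ x =
    (Σ.congˡ (λ {e} → least-at e) ×-⇔ ¬-cong-⇔ (sat-least θ x w x≢w))
    ×-⇔ Π-cong-⇔ λ d →
      →-cong-⇔ (≡⇒⇔ (cong₂ (R N) (update-≡ θ z d) (update-≢ θ z d x≢z)))
               (least-at d ⊎-⇔ ≡⇒⇔ (cong₂ _≡_ (update-≡ θ z d) (update-≢ θ z d x≢z)))
    where
    z w : Var
    z = suc x
    w = suc (suc x)
    x≢z : x ≢ z
    x≢z = <⇒≢ (n<1+n x)
    x≢w : x ≢ w
    x≢w = <⇒≢ (m<n⇒m<1+n (n<1+n x))
    z≢w : z ≢ w
    z≢w = <⇒≢ (n<1+n z)
    least-at : ∀ e → Sat N (_[_↦_] {N} θ z e) (∀' w (rel z w)) ⇔ IsLeast e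
    least-at e = ⇔-trans (sat-least _ z w z≢w) (≡⇒⇔ (cong IsLeast (update-≡ θ z e)))

  sat-Atm-update : ∀ θ v c → Sat N (_[_↦_] {N} θ v c) (Atm v) ⇔ IsAtom c
  sat-Atm-update θ v c = ⇔-trans (sat-Atm _ v) (≡⇒⇔ (cong IsAtom (update-≡ θ v c)))

module Translation (em : ExcludedMiddle) (𝓜 : Structure) (bas : IsBAS 𝓜) where
  open IsBAS bas

  private
    M = Carrier 𝓜
    _∈ᴹ_ = R 𝓜
    _⊆_ = _⊆ᴹ_ 𝓜
    I = InclStr 𝓜

  IsSingletonOf : M → M → Set
  IsSingletonOf c a = ∀ u → u ∈ᴹ c ⇔ u ≡ a

  ∅ : M
  ∅ = proj₁ emp

  ∉∅ : ∀ u → ¬ u ∈ᴹ ∅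
  ∉∅ = proj₂ emp

  ∅-least : IsLeast I ∅
  ∅-least f u u∈∅ = ⊥-elim (∉∅ u u∈∅)

  ｛_｝ : M → M
  ｛ a ｝ = proj₁ (adj ∅ a)

  ｛｝-isSingleton : ∀ a → IsSingletonOf ｛ a ｝ a
  ｛｝-isSingleton a u = ⇔-trans (proj₂ (adj ∅ a) u) (mk⇔ from-∅-or-a inj₂)
    where
    from-∅-or-a : u ∈ᴹ ∅ ⊎ u ≡ a → u ≡ a
    from-∅-or-a (inj₁ u∈∅) = ⊥-elim (∉∅ u u∈∅)
    from-∅-or-a (inj₂ u≡a) = u≡a

  ∈⇔singleton⊆ : ∀ {a b c} → IsSingletonOf c a → a ∈ᴹ b ⇔ c ⊆ b
  ∈⇔singleton⊆ {a} {b} c≡｛a｝ = mk⇔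
    (λ a∈b u u∈c → subst (_∈ᴹ b) (sym (to (c≡｛a｝ u) u∈c)) a∈b)
    (λ c⊆b → c⊆b a (from (c≡｛a｝ a) refl))

  singleton-isAtom : ∀ {a c} → IsSingletonOf c a → IsAtom I c
  singleton-isAtom {a} {c} c≡｛a｝ =
    ((∅ , ∅-least) , λ c-least → ∉∅ a (c-least ∅ a (from (c≡｛a｝ a) refl))) , below
    where
    below : ∀ d → d ⊆ c → IsLeast I d ⊎ d ≡ c
    below d d⊆c with em (a ∈ᴹ d)
    ... | yes a∈d = inj₂ (ext d c λ u →
      mk⇔ (d⊆c u) (λ u∈c → subst (_∈ᴹ d) (sym (to (c≡｛a｝ u) u∈c)) a∈d))
    ... | no a∉d = inj₁ λ f u u∈d →
      ⊥-elim (a∉d (subst (_∈ᴹ d) (to (c≡｛a｝ u) (d⊆c u u∈d)) u∈d))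

  -- An atom c is inhabited, being no least element; for any a ∈ c the singleton ｛ a ｝ ⊆ c
  -- is not least either, so it is c itself.
  atom-isSingleton : ∀ {c} → IsAtom I c → Σ M (IsSingletonOf c)
  atom-isSingleton {c} ((_ , c-not-least) , below) with em (Σ M (_∈ᴹ c))
  ... | no c-empty = ⊥-elim (c-not-least λ f u u∈c → ⊥-elim (c-empty (u , u∈c)))
  ... | yes (a , a∈c) with below ｛ a ｝ (to (∈⇔singleton⊆ (｛｝-isSingleton a)) a∈c)
  ...   | inj₁ ｛a｝-least = ⊥-elim (∉∅ a (｛a｝-least ∅ a (from (｛｝-isSingleton a a) refl)))
  ...   | inj₂ ｛a｝≡c = a , subst (λ s → IsSingletonOf s a) ｛a｝≡c (｛｝-isSingleton a)

  singleton-≡ : ∀ {a b c d} → IsSingletonOf c a → IsSingletonOf d b → (a ≡ b) ⇔ (c ≡ d)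
  singleton-≡ {a} {b} {c} {d} c≡｛a｝ d≡｛b｝ = mk⇔
    (λ a≡b → ext c d λ u →
      ⇔-trans (c≡｛a｝ u) (⇔-trans (≡⇒⇔ (cong (u ≡_) a≡b)) (⇔-sym (d≡｛b｝ u))))
    (λ c≡d → to (d≡｛b｝ a) (subst (a ∈ᴹ_) c≡d (from (c≡｛a｝ a) refl)))

  ∈⇔atom×⊆ : ∀ {a b c} → IsSingletonOf c a → a ∈ᴹ b ⇔ (IsAtom I c × c ⊆ b)
  ∈⇔atom×⊆ c≡｛a｝ = mk⇔
    (λ a∈b → singleton-isAtom c≡｛a｝ , to (∈⇔singleton⊆ c≡｛a｝) a∈b)
    (λ (_ , c⊆b) → from (∈⇔singleton⊆ c≡｛a｝) c⊆b)

  Σ-singletons-⇔ : {P Q : M → Set} → (∀ {a c} → IsSingletonOf c a → P a ⇔ Q c) →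
                   Σ M P ⇔ Σ M (λ c → IsAtom I c × Q c)
  Σ-singletons-⇔ P⇔Q = mk⇔
    (λ (a , pa) → ｛ a ｝ , singleton-isAtom (｛｝-isSingleton a) , to (P⇔Q (｛｝-isSingleton a)) pa)
    (λ (c , c-atom , qc) → let (a , c≡｛a｝) = atom-isSingleton c-atom in a , from (P⇔Q c≡｛a｝) qc)

  Π-singletons-⇔ : {P Q : M → Set} → (∀ {a c} → IsSingletonOf c a → P a ⇔ Q c) →
                   ((a : M) → P a) ⇔ ((c : M) → IsAtom I c → Q c)
  Π-singletons-⇔ P⇔Q = mk⇔
    (λ ∀P c c-atom → let (a , c≡｛a｝) = atom-isSingleton c-atom in to (P⇔Q c≡｛a｝) (∀P a))
    (λ ∀Q a → from (P⇔Q (｛｝-isSingleton a)) (∀Q ｛ a ｝ (singleton-isAtom (｛｝-isSingleton a))))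

  Represents : ℕ → M → M → Set
  Represents zero    c a = IsSingletonOf c a
  Represents (suc _) c a = c ≡ a

  represents-≡ : ∀ ℓ {a b c d} → Represents ℓ c a → Represents ℓ d b → (a ≡ b) ⇔ (c ≡ d)
  represents-≡ zero    = singleton-≡
  represents-≡ (suc _) refl refl = ⇔-refl

  module _ (σ : Var → ℕ) where

    CorrespondOn : Env 𝓜 → Env I → List Var → Set
    CorrespondOn ρ ρ' vs = ∀ {v} → v ∈ vs → Represents (σ v) (ρ' v) (ρ v)

    BoundedOn : List Var → Set
    BoundedOn vs = ∀ {v} → v ∈ vs → σ v ≤ 1

    correspondOn-update : ∀ {ρ ρ' v a c} vs → CorrespondOn ρ ρ' (remove v vs) →
      Represents (σ v) c a → CorrespondOn (_[_↦_] {𝓜} ρ v a) (_[_↦_] {I} ρ' v c) vs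
    correspondOn-update {ρ} {ρ'} {v} {a} {c} vs corr c≈a {w} w∈vs with toSum (w ≟ v)
    ... | inj₁ refl = subst₂ (Represents (σ w)) (sym (update-≡ ρ' w c)) (sym (update-≡ ρ w a)) c≈a
    ... | inj₂ w≢v  = subst₂ (Represents (σ w)) (sym (update-≢ ρ' v c w≢v)) (sym (update-≢ ρ v a w≢v))
                            (corr (∈-filter⁺ (λ u → ¬? (u ≟ v)) w∈vs w≢v))

    represents-at : ∀ {v ℓ c a} → σ v ≡ ℓ → Represents ℓ c a → Represents (σ v) c a
    represents-at {c = c} {a} σv≡ℓ = subst (λ ℓ → Represents ℓ c a) (sym σv≡ℓ)

    translate : ∀ φ → StratCond σ φ → BoundedOn (Vars φ) →
      ∀ {ρ ρ'} → CorrespondOn ρ ρ' (FV φ) → Sat 𝓜 ρ φ ⇔ Sat I ρ' (τ σ φ)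

    translateˡ : ∀ φ ψ → StratCond σ φ → BoundedOn (Vars φ ++ Vars ψ) →
      ∀ {ρ ρ'} → CorrespondOn ρ ρ' (FV φ ++ FV ψ) → Sat 𝓜 ρ φ ⇔ Sat I ρ' (τ σ φ)
    translateˡ φ ψ st bd corr = translate φ st (λ m → bd (∈-++⁺ˡ m)) (λ m → corr (∈-++⁺ˡ m))

    translateʳ : ∀ φ ψ → StratCond σ ψ → BoundedOn (Vars φ ++ Vars ψ) →
      ∀ {ρ ρ'} → CorrespondOn ρ ρ' (FV φ ++ FV ψ) → Sat 𝓜 ρ ψ ⇔ Sat I ρ' (τ σ ψ)
    translateʳ φ ψ st bd corr =
      translate ψ st (λ m → bd (∈-++⁺ʳ (Vars φ) m)) (λ m → corr (∈-++⁺ʳ (FV φ) m))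

    translate-update : ∀ v φ → StratCond σ φ → BoundedOn (v ∷ Vars φ) →
      ∀ {ρ ρ'} → CorrespondOn ρ ρ' (remove v (FV φ)) → ∀ {a c} → Represents (σ v) c a →
      Sat 𝓜 (_[_↦_] {𝓜} ρ v a) φ ⇔ Sat I (_[_↦_] {I} ρ' v c) (τ σ φ)
    translate-update v φ st bd corr c≈a =
      translate φ st (λ m → bd (there m)) (correspondOn-update (FV φ) corr c≈a)

    -- σ y = σ x + 1 ≤ 1 forces x to level 0 and y to level 1.
    translate (rel x y) st bd {ρ} {ρ'} corr =
      ⇔-trans (≡⇒⇔ (cong (ρ x ∈ᴹ_) (sym y-rep)))
              (⇔-trans (∈⇔atom×⊆ x-rep) (⇔-sym (sat-Atm I ρ' x) ×-⇔ ⇔-refl))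
      where
      σx≡0 : σ x ≡ 0
      σx≡0 = n≤0⇒n≡0 (s≤s⁻¹ (subst (_≤ 1) st (bd (there (here refl)))))
      x-rep : IsSingletonOf (ρ' x) (ρ x)
      x-rep = subst (λ ℓ → Represents ℓ (ρ' x) (ρ x)) σx≡0 (corr (here refl))
      y-rep : ρ' y ≡ ρ y
      y-rep = subst (λ ℓ → Represents ℓ (ρ' y) (ρ y)) st (corr (there (here refl)))
    translate (x ≐ y) st bd {ρ} {ρ'} corr =
      represents-≡ (σ x) (corr (here refl))
        (subst (λ ℓ → Represents ℓ (ρ' y) (ρ y)) st (corr (there (here refl))))
    translate (¬' φ) st bd corr = ¬-cong-⇔ (translate φ st bd corr)
    translate (φ ∧' ψ) (st₁ , st₂) bd corr =
      translateˡ φ ψ st₁ bd corr ×-⇔ translateʳ φ ψ st₂ bd corr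
    translate (φ ∨' ψ) (st₁ , st₂) bd corr =
      translateˡ φ ψ st₁ bd corr ⊎-⇔ translateʳ φ ψ st₂ bd corr
    translate (φ ⇒' ψ) (st₁ , st₂) bd corr =
      →-cong-⇔ (translateˡ φ ψ st₁ bd corr) (translateʳ φ ψ st₂ bd corr)
    translate (φ ⇔' ψ) (st₁ , st₂) bd corr =
      Related-cong {k = equivalence} (translateˡ φ ψ st₁ bd corr) (translateʳ φ ψ st₂ bd corr)
    translate (∃' v φ) st bd {ρ' = ρ'} corr with σ v in σv
    ... | zero = ⇔-trans
      (Σ-singletons-⇔ λ c≡｛a｝ → translate-update v φ st bd corr (represents-at σv c≡｛a｝))
      (Σ.congˡ λ {c} → ⇔-sym (sat-Atm-update I ρ' v c) ×-⇔ ⇔-refl)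
    ... | suc _ = Σ.congˡ (translate-update v φ st bd corr (represents-at σv refl))
    translate (∀' v φ) st bd {ρ' = ρ'} corr with σ v in σv
    ... | zero = ⇔-trans
      (Π-singletons-⇔ λ c≡｛a｝ → translate-update v φ st bd corr (represents-at σv c≡｛a｝))
      (Π-cong-⇔ λ c → →-cong-⇔ (⇔-sym (sat-Atm-update I ρ' v c)) ⇔-refl)
    ... | suc _ = Π-cong-⇔ λ a → translate-update v φ st bd corr (represents-at σv refl)

mainTheorem5 : ExcludedMiddle →
    (n m : ℕ) (xs : Fin n → Var) (ys : Fin m → Var)
    (φ : Formula) (σ : Var → ℕ) →
    IsStrat01 σ φ →
    (∀ i → σ (xs i) ≡ 0) →
    (∀ j → σ (ys j) ≡ 1) →
    (∀ {v} → v ∈ FV φ → Σ (Fin n) (λ i → v ≡ xs i) ⊎ Σ (Fin m) (λ j → v ≡ ys j)) →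
    (𝓜 : Structure) → IsBAS 𝓜 →
    (a : Fin n → Carrier 𝓜) (b : Fin m → Carrier 𝓜) →
    (ρ ρ' : Env 𝓜) →
    (∀ i → ρ (xs i) ≡ a i) →
    (∀ j → ρ (ys j) ≡ b j) →
    (∀ i u → R 𝓜 u (ρ' (xs i)) ⇔ (u ≡ a i)) →
    (∀ j → ρ' (ys j) ≡ b j) →
    Sat 𝓜 ρ φ ⇔ Sat (InclStr 𝓜) ρ' (τ σ φ)
mainTheorem5 em n m xs ys φ σ (st , bd) σx σy fv 𝓜 bas a b ρ ρ' ρx ρy ρ'x ρ'y =
  translate σ φ st bd corr
  where
  open Translation em 𝓜 bas
  corr : CorrespondOn σ ρ ρ' (FV φ)
  corr v∈FV with fv v∈FV
  ... | inj₁ (i , refl) = represents-at σ (σx i) (subst (IsSingletonOf (ρ' (xs i))) (sym (ρx i)) (ρ'x i))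
  ... | inj₂ (j , refl) = represents-at σ (σy j) (trans (ρ'y j) (sym (ρy j)))
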